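{- A network has the global lca-property if and only if it is a holju graph.
   Context: A DAG is a finite directed graph without loops and directed cycles; $u\preceq_G v$ means there is a directed path from $v$ to $u$ (including $u=v$). A leaf is a $\preceq_G$-minimal vertex. A network is a DAG with exactly one $\preceq_G$-maximal vertex. For non-empty $A\subseteq V(G)$, $\mathrm{LCA}_G(A)$ is the set of $\preceq_G$-minimal vertices $v$ with $a\preceq_G v$ for all $a\in A$; $G$ has the global lca-property if $|\mathrm{LCA}_G(A)|=1$ for all non-empty $A\subseteq V(G)$. For a DAG $G$, $W\subseteq V(G)$ and $v\in V(G)$, put $\mathcal{L}_G(W\mid v)=\bigcup_{w\in W}\mathrm{LCA}_G(\{w,v\})$. The class of holju graphs is defined recursively: the single-vertex graph $K_1$ is holju; if $G$ is holju, then so is any graph obtained from $G$ by adding a new vertex $x\notin V(G)$ together with edges $(w,x)$ for all $w\in W$, where $W\subseteq V(G)$ is non-empty and, for every $v\in V(G)$, the set $\mathcal{L}_G(W\mid v)$ contains a unique $\preceq_G$-minimal vertex ($|W|=1$ allowed). -}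

module Defs where

open import Data.Nat using (ℕ; suc)
open import Data.Fin using (Fin; zero; suc)
open import Data.Fin.Subset using (Subset; _∈_; Nonempty)
open import Data.Fin.Permutation using (Permutation; _⟨$⟩ʳ_)
open import Data.Bool using (Bool; true; false; T)
open import Data.Vec using (lookup)
open import Data.Product using (Σ; ∃; _×_; _,_)
open import Data.Sum using (_⊎_)
open import Relation.Binary.PropositionalEquality using (_≡_)
open import Relation.Nullary using (¬_)
open import Relation.Unary using (Pred)
open import Level using (0ℓ)

-- A finite directed graph on the vertex set Fin n:
-- G u v ≡ true  iff  (u , v) is an edge u → v.
Graph : ℕ → Set
Graph n = Fin n → Fin n → Bool

Edge : ∀ {n} → Graph n → Fin n → Fin n → Set
Edge G u v = T (G u v)

-- u ⪯[ G ] v : there is a directed path from v to u (possibly u = v).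
data _⪯[_]_ {n : ℕ} : Fin n → Graph n → Fin n → Set where
  ⪯-refl : ∀ {G u} → u ⪯[ G ] u
  ⪯-step : ∀ {G u v w} → Edge G v w → u ⪯[ G ] w → u ⪯[ G ] v

data Reach⁺ {n : ℕ} (G : Graph n) : Fin n → Fin n → Set where
  step : ∀ {u v w} → Edge G v w → u ⪯[ G ] w → Reach⁺ G u v

DAG : ∀ {n} → Graph n → Set
DAG {n} G = ∀ (v : Fin n) → ¬ Reach⁺ G v v

IsMaximal : ∀ {n} → Graph n → Fin n → Set
IsMaximal {n} G v = ∀ (w : Fin n) → v ⪯[ G ] w → w ≡ v

Network : ∀ {n} → Graph n → Set
Network {n} G = DAG G × Σ (Fin n) (λ r → IsMaximal G r × (∀ m → IsMaximal G m → m ≡ r))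

ExactlyOne : ∀ {n} → Pred (Fin n) 0ℓ → Set
ExactlyOne {n} S = Σ (Fin n) (λ v → S v × (∀ u → S u → u ≡ v))

IsMinimalIn : ∀ {n} → Graph n → Pred (Fin n) 0ℓ → Fin n → Set
IsMinimalIn {n} G S v = S v × (∀ (u : Fin n) → S u → u ⪯[ G ] v → u ≡ v)

CommonAnc : ∀ {n} → Graph n → Pred (Fin n) 0ℓ → Pred (Fin n) 0ℓ
CommonAnc {n} G A v = ∀ (a : Fin n) → A a → a ⪯[ G ] v

LCA : ∀ {n} → Graph n → Pred (Fin n) 0ℓ → Pred (Fin n) 0ℓ
LCA G A = IsMinimalIn G (CommonAnc G A)

GlobalLCA : ∀ {n} → Graph n → Set
GlobalLCA {n} G = ∀ (A : Subset n) → Nonempty A → ExactlyOne (LCA G (_∈ A))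

pair : ∀ {n} → Fin n → Fin n → Pred (Fin n) 0ℓ
pair w v a = a ≡ w ⊎ a ≡ v

𝓛 : ∀ {n} → Graph n → Subset n → Fin n → Pred (Fin n) 0ℓ
𝓛 {n} G W v x = Σ (Fin n) (λ w → w ∈ W × LCA G (pair w v) x)

HasUniqueMinimal : ∀ {n} → Graph n → Pred (Fin n) 0ℓ → Set
HasUniqueMinimal G S = ExactlyOne (IsMinimalIn G S)

Admissible : ∀ {n} → Graph n → Subset n → Set
Admissible {n} G W = Nonempty W × (∀ (v : Fin n) → HasUniqueMinimal G (𝓛 G W v))

-- adding a new vertex x (placed at index zero) with edges (w , x) for w ∈ W
extend : ∀ {n} → Graph n → Subset n → Graph (suc n)
extend G W zero    _       = false
extend G W (suc w) zero    = lookup W w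
extend G W (suc a) (suc b) = G a b

data HoljuBuilt : (n : ℕ) → Graph n → Set where
  K₁  : HoljuBuilt 1 (λ _ _ → false)
  add : ∀ {n} {G : Graph n} (W : Subset n) →
        HoljuBuilt n G → Admissible G W → HoljuBuilt (suc n) (extend G W)

_≅_ : ∀ {n} → Graph n → Graph n → Set
_≅_ {n} G H = Σ (Permutation n n) (λ π → ∀ u v → G u v ≡ H (π ⟨$⟩ʳ u) (π ⟨$⟩ʳ v))

-- holju graphs: the class generated by the construction (closed under isomorphism,
-- i.e. independent of vertex names)
Holju : ∀ {n} → Graph n → Set
Holju {n} G = Σ (Graph n) (λ H → HoljuBuilt n H × G ≅ H)

{-# OPTIONS --safe #-}
-- In a DAG the global lca-property says exactly that every non-empty vertex set A has a
-- least common ancestor, i.e. one lying below every other common ancestor of A; this is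
-- the form carried along isomorphisms and through the holju step. Adding a vertex x below
-- W preserves it: for a set consisting of x and old vertices B it is the least element of
-- 𝓛(W | lca B), since every common ancestor y of the set lies above some w ∈ W and above
-- lca B, hence above lca {w , lca B}. Conversely, deleting a leaf x keeps the property, and
-- lca {x , v} is the least element of 𝓛(parents of x | v), so the parents of x are
-- admissible; induction on the number of vertices, always deleting a leaf, then rebuilds
-- any network with the property by the holju construction.
module Submission where

open import Defs
open import Data.Nat using (ℕ; zero; suc)
open import Data.Fin using (Fin; zero; suc)
open import Data.Fin.Properties using (_≟_; any?; all?)
open import Data.Fin.Induction using (spo-wellFounded)
open import Data.Fin.Subset using (Subset; _∈_)
open import Data.Fin.Subset.Properties using (_∈?_)
open import Data.Fin.Permutation
  using (Permutation; _⟨$⟩ʳ_; _⟨$⟩ˡ_; inverseˡ; inverseʳ; flip; _∘ₚ_; id; lift₀; transpose)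
open import Data.Bool using (false; T)
open import Data.Bool.Properties using (T-≡)
open import Data.Empty using (⊥; ⊥-elim)
open import Data.Vec using (lookup; tabulate)
open import Data.Vec.Properties using (lookup∘tabulate; []=⇒lookup; lookup⇒[]=)
open import Data.Product using (Σ; ∃; ∃₂; _×_; _,_; proj₁; proj₂)
open import Data.Sum using (_⊎_; inj₁; inj₂; [_,_]′; fromInj₁)
open import Function using (_∘_)
open import Function.Bundles using (_⇔_; mk⇔; Equivalence)
open import Induction.WellFounded using (WellFounded; module All)
open import Level using (0ℓ)
open import Relation.Binary.Structures using (IsStrictPartialOrder)
open import Relation.Binary.PropositionalEquality
  using (_≡_; refl; sym; trans; cong; cong₂; subst; isEquivalence; resp₂)
open import Relation.Nullary using (¬_; Dec; yes; no; does)
open import Relation.Nullary.Decidable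
  using (T?; _×-dec_; _⊎-dec_; _→-dec_; map′; isYes≗does; dec-true; dec-false; toWitness)
open import Relation.Unary using (Pred; Decidable; _⊆_; _≐_)
open import Relation.Unary.Properties using (U?)

IsLeastIn : ∀ {n} → Graph n → Pred (Fin n) 0ℓ → Fin n → Set
IsLeastIn {n} G S s = S s × (∀ t → S t → s ⪯[ G ] t)

HasLeastCommonAncestors : ∀ {n} → Graph n → Set₁
HasLeastCommonAncestors {n} G =
  ∀ {A : Pred (Fin n) 0ℓ} → Decidable A → ∃ A → ∃ (IsLeastIn G (CommonAnc G A))

pair-dec : ∀ {n} (w v : Fin n) → Decidable (pair w v)
pair-dec w v a = a ≟ w ⊎-dec a ≟ v

module _ {n : ℕ} {G : Graph n} where

  ⪯-trans : ∀ {a b c} → a ⪯[ G ] b → b ⪯[ G ] c → a ⪯[ G ] c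
  ⪯-trans p ⪯-refl       = p
  ⪯-trans p (⪯-step e q) = ⪯-step e (⪯-trans p q)

  Reach⁺⇒⪯ : ∀ {u v} → Reach⁺ G u v → u ⪯[ G ] v
  Reach⁺⇒⪯ (step e p) = ⪯-step e p

  ⪯⇒≡⊎Reach⁺ : ∀ {u v} → u ⪯[ G ] v → u ≡ v ⊎ Reach⁺ G u v
  ⪯⇒≡⊎Reach⁺ ⪯-refl       = inj₁ refl
  ⪯⇒≡⊎Reach⁺ (⪯-step e p) = inj₂ (step e p)

  Reach⁺-trans : ∀ {a b c} → Reach⁺ G a b → Reach⁺ G b c → Reach⁺ G a c
  Reach⁺-trans r (step e p) = step e (⪯-trans (Reach⁺⇒⪯ r) p)

  ⪯-antisym : DAG G → ∀ {u v} → u ⪯[ G ] v → v ⪯[ G ] u → u ≡ v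
  ⪯-antisym dag ⪯-refl       _ = refl
  ⪯-antisym dag (⪯-step e p) q = ⊥-elim (dag _ (step e (⪯-trans q p)))

  CommonAnc-pair : ∀ {a b x} → a ⪯[ G ] x → b ⪯[ G ] x → CommonAnc G (pair a b) x
  CommonAnc-pair p q _ (inj₁ refl) = p
  CommonAnc-pair p q _ (inj₂ refl) = q

  CommonAnc-resp-≐ : ∀ {A B : Pred (Fin n) 0ℓ} → A ≐ B → CommonAnc G A ≐ CommonAnc G B
  CommonAnc-resp-≐ (A⊆B , B⊆A) = (λ c b Bb → c b (B⊆A Bb)) , (λ c a Aa → c a (A⊆B Aa))

  IsLeastIn-resp-≐ : ∀ {S T : Pred (Fin n) 0ℓ} → S ≐ T → IsLeastIn G S ⊆ IsLeastIn G T
  IsLeastIn-resp-≐ (S⊆T , T⊆S) (Ss , least) = S⊆T Ss , λ t Tt → least t (T⊆S Tt)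

module _ {n : ℕ} {G : Graph n} (dag : DAG G) where

  Reach⁺-isStrictPartialOrder : IsStrictPartialOrder _≡_ (Reach⁺ G)
  Reach⁺-isStrictPartialOrder = record
    { isEquivalence = isEquivalence
    ; irrefl        = λ { refl → dag _ }
    ; trans         = Reach⁺-trans
    ; <-resp-≈      = resp₂ (Reach⁺ G)
    }

  Reach⁺-wellFounded : WellFounded (Reach⁺ G)
  Reach⁺-wellFounded = spo-wellFounded Reach⁺-isStrictPartialOrder

  open All Reach⁺-wellFounded 0ℓ using (wfRec)

  ⪯-dec : ∀ u v → Dec (u ⪯[ G ] v)
  ⪯-dec u = wfRec (λ v → Dec (u ⪯[ G ] v)) decide
    where
    decide : ∀ v → (∀ {c} → Reach⁺ G c v → Dec (u ⪯[ G ] c)) → Dec (u ⪯[ G ] v)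
    decide v below with u ≟ v
    ... | yes refl = yes ⪯-refl
    ... | no u≢v   = map′ (λ (_ , e , p) → ⪯-step e p) via-child (any? child?)
      where
      child? : ∀ c → Dec (Σ (Edge G v c) λ _ → u ⪯[ G ] c)
      child? c with T? (G v c)
      ... | yes e = map′ (e ,_) proj₂ (below (step e ⪯-refl))
      ... | no ¬e = no (¬e ∘ proj₁)
      via-child : u ⪯[ G ] v → ∃ λ c → Σ (Edge G v c) λ _ → u ⪯[ G ] c
      via-child ⪯-refl       = ⊥-elim (u≢v refl)
      via-child (⪯-step e p) = _ , e , p

  Reach⁺-dec : ∀ u v → Dec (Reach⁺ G u v)
  Reach⁺-dec u v = map′ (λ (_ , e , p) → step e p) (λ { (step e p) → _ , e , p })
                        (any? λ c → T? (G v c) ×-dec ⪯-dec u c)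

  CommonAnc-dec : ∀ {A} → Decidable A → Decidable (CommonAnc G A)
  CommonAnc-dec A? v = all? λ a → A? a →-dec ⪯-dec a v

  IsMinimalIn-dec : ∀ {S} → Decidable S → Decidable (IsMinimalIn G S)
  IsMinimalIn-dec S? x = S? x ×-dec all? λ u → S? u →-dec (⪯-dec u x →-dec u ≟ x)

  𝓛-dec : ∀ W v → Decidable (𝓛 G W v)
  𝓛-dec W v x = any? λ w → w ∈? W ×-dec IsMinimalIn-dec (CommonAnc-dec (pair-dec w v)) x

  minimal-below : ∀ {S} → Decidable S → ∀ {k} → S k → ∃ λ s → IsMinimalIn G S s × s ⪯[ G ] k
  minimal-below {S} S? {k} = wfRec P descend k
    where
    P : Pred (Fin n) 0ℓ
    P k = S k → ∃ λ s → IsMinimalIn G S s × s ⪯[ G ] k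
    descend : ∀ k → (∀ {u} → Reach⁺ G u k → P u) → P k
    descend k below Sk with any? (λ u → S? u ×-dec Reach⁺-dec u k)
    ... | yes (u , Su , u<k) =
      let (s , s-min , s⪯u) = below u<k Su in s , s-min , ⪯-trans s⪯u (Reach⁺⇒⪯ u<k)
    ... | no none = k , (Sk , minimal) , ⪯-refl
      where
      minimal : ∀ u → S u → u ⪯[ G ] k → u ≡ k
      minimal u Su u⪯k = fromInj₁ (λ u<k → ⊥-elim (none (u , Su , u<k))) (⪯⇒≡⊎Reach⁺ u⪯k)

  leaf-exists : Fin n → ∃ λ x → ∀ c → ¬ Edge G x c
  leaf-exists v with minimal-below U? {v} _
  ... | x , (_ , x-min) , _ = x , no-edge
    where
    no-edge : ∀ c → ¬ Edge G x c
    no-edge c e with x-min c _ (⪯-step e ⪯-refl)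
    ... | refl = dag x (step e ⪯-refl)

  least⇒minimal : ∀ {S s} → IsLeastIn G S s → IsMinimalIn G S s
  least⇒minimal (Ss , least) = Ss , λ u Su u⪯s → ⪯-antisym dag u⪯s (least u Su)

  least⇒uniqueMinimal : ∀ {S s} → IsLeastIn G S s → HasUniqueMinimal G S
  least⇒uniqueMinimal {s = s} L@(Ss , least) =
    s , least⇒minimal L , λ u (Su , u-min) → sym (u-min s Ss (least u Su))

  uniqueMinimal⇒least : ∀ {S} → Decidable S → HasUniqueMinimal G S → ∃ (IsLeastIn G S)
  uniqueMinimal⇒least {S} S? (m , (Sm , _) , unique) = m , Sm , least
    where
    least : ∀ t → S t → m ⪯[ G ] t
    least t St = let (s , s-min , s⪯t) = minimal-below S? St in subst (_⪯[ G ] t) (unique s s-min) s⪯t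

fromDec : ∀ {n} {P : Pred (Fin n) 0ℓ} → Decidable P → Subset n
fromDec P? = tabulate (does ∘ P?)

∈-fromDec : ∀ {n} {P : Pred (Fin n) 0ℓ} (P? : Decidable P) → (_∈ fromDec P?) ≐ P
∈-fromDec P? =
    (λ {x} x∈ → toWitness {a? = P? x} (Equivalence.from T-≡
                  (trans (isYes≗does (P? x)) (trans (sym (lookup∘tabulate _ x)) ([]=⇒lookup x∈)))))
  , (λ {x} Px → lookup⇒[]= x _ (trans (lookup∘tabulate _ x) (dec-true (P? x) Px)))

globalLCA⇔leastCA : ∀ {n} {G : Graph n} → DAG G → GlobalLCA G ⇔ HasLeastCommonAncestors G
globalLCA⇔leastCA {G = G} dag = mk⇔ least unique
  where
  least : GlobalLCA G → HasLeastCommonAncestors G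
  least gl A? (a , Aa) =
    let A = fromDec A?
        (s , s-least) = uniqueMinimal⇒least dag (CommonAnc-dec dag (_∈? A))
                                            (gl A (a , proj₂ (∈-fromDec A?) Aa))
    in s , IsLeastIn-resp-≐ (CommonAnc-resp-≐ (∈-fromDec A?)) s-least
  unique : HasLeastCommonAncestors G → GlobalLCA G
  unique lca A A≢∅ = least⇒uniqueMinimal dag (proj₂ (lca (_∈? A) A≢∅))

≅-sym : ∀ {n} {G H : Graph n} → G ≅ H → H ≅ G
≅-sym {H = H} (π , e) = flip π , λ a b → sym (trans (e _ _) (cong₂ H (inverseʳ π) (inverseʳ π)))

≅-trans : ∀ {n} {G H K : Graph n} → G ≅ H → H ≅ K → G ≅ K
≅-trans (π , e) (ρ , f) = π ∘ₚ ρ , λ u v → trans (e u v) (f _ _)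

module _ {n : ℕ} {G H : Graph n} (G≅H : G ≅ H) where
  private
    π : Permutation n n
    π = proj₁ G≅H

  Edge-map : ∀ {u v} → Edge G u v → Edge H (π ⟨$⟩ʳ u) (π ⟨$⟩ʳ v)
  Edge-map = subst T (proj₂ G≅H _ _)

  ⪯-map : ∀ {u v} → u ⪯[ G ] v → (π ⟨$⟩ʳ u) ⪯[ H ] (π ⟨$⟩ʳ v)
  ⪯-map ⪯-refl       = ⪯-refl
  ⪯-map (⪯-step e p) = ⪯-step (Edge-map e) (⪯-map p)

  Reach⁺-map : ∀ {u v} → Reach⁺ G u v → Reach⁺ H (π ⟨$⟩ʳ u) (π ⟨$⟩ʳ v)
  Reach⁺-map (step e p) = step (Edge-map e) (⪯-map p)

module _ {n : ℕ} {G H : Graph n} (G≅H : G ≅ H) where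
  private
    π : Permutation n n
    π = proj₁ G≅H
    H≅G : H ≅ G
    H≅G = ≅-sym G≅H
    A-inverseʳ : ∀ {A : Pred (Fin n) 0ℓ} {y} → A y → A (π ⟨$⟩ʳ (π ⟨$⟩ˡ y))
    A-inverseʳ {A} = subst A (sym (inverseʳ π))

  DAG-transport : DAG G → DAG H
  DAG-transport dag v r = dag (π ⟨$⟩ˡ v) (Reach⁺-map H≅G r)

  leastCA-transport : HasLeastCommonAncestors G → HasLeastCommonAncestors H
  leastCA-transport lca {A} A? (a , Aa) with lca (A? ∘ (π ⟨$⟩ʳ_)) (π ⟨$⟩ˡ a , A-inverseʳ {A} Aa)
  ... | s , s-CA , s-least = π ⟨$⟩ʳ s , CA , least
    where
    CA : CommonAnc H A (π ⟨$⟩ʳ s)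
    CA y Ay = subst (_⪯[ H ] (π ⟨$⟩ʳ s)) (inverseʳ π)
                    (⪯-map G≅H (s-CA (π ⟨$⟩ˡ y) (A-inverseʳ {A} Ay)))
    least : ∀ t → CommonAnc H A t → (π ⟨$⟩ʳ s) ⪯[ H ] t
    least t t-CA = subst ((π ⟨$⟩ʳ s) ⪯[ H ]_) (inverseʳ π)
                         (⪯-map G≅H (s-least (π ⟨$⟩ˡ t) t-CA′))
      where
      t-CA′ : CommonAnc G (A ∘ (π ⟨$⟩ʳ_)) (π ⟨$⟩ˡ t)
      t-CA′ a Aπa = subst (_⪯[ G ] (π ⟨$⟩ˡ t)) (inverseˡ π)
                          (⪯-map H≅G (t-CA (π ⟨$⟩ʳ a) Aπa))

extend-≅ : ∀ {n} {G H : Graph n} → G ≅ H → ∀ W → ∃ λ W′ → extend G W ≅ extend H W′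
extend-≅ {G = G} {H} (π , e) W = W′ , lift₀ π , edges
  where
  W′ : Subset _
  W′ = tabulate (lookup W ∘ (π ⟨$⟩ˡ_))
  edges : ∀ u v → extend G W u v ≡ extend H W′ (lift₀ π ⟨$⟩ʳ u) (lift₀ π ⟨$⟩ʳ v)
  edges zero    v       = refl
  edges (suc a) zero    = sym (trans (lookup∘tabulate _ (π ⟨$⟩ʳ a)) (cong (lookup W) (inverseˡ π)))
  edges (suc a) (suc b) = e a b

split-leaf : ∀ {n} {G : Graph (suc n)} {x} → (∀ c → ¬ Edge G x c) →
             ∃₂ λ G′ W → G ≅ extend G′ W
split-leaf {n} {G} {x} x-leaf = G′ , W , ≅-sym (τ , edges)
  where
  τ : Permutation (suc n) (suc n)
  τ = transpose zero x
  G′ : Graph n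
  G′ a b = G (τ ⟨$⟩ʳ suc a) (τ ⟨$⟩ʳ suc b)
  W : Subset n
  W = tabulate λ a → G (τ ⟨$⟩ʳ suc a) x
  edges : ∀ u v → extend G′ W u v ≡ G (τ ⟨$⟩ʳ u) (τ ⟨$⟩ʳ v)
  edges zero    v       = sym (dec-false (T? (G x _)) (x-leaf _))
  edges (suc a) zero    = lookup∘tabulate _ a
  edges (suc a) (suc b) = refl

module Extension {n : ℕ} (H : Graph n) (W : Subset n) where

  private
    E : Graph (suc n)
    E = extend H W

  suc-⪯⁺ : ∀ {a b} → a ⪯[ H ] b → suc a ⪯[ E ] suc b
  suc-⪯⁺ ⪯-refl       = ⪯-refl
  suc-⪯⁺ (⪯-step e p) = ⪯-step e (suc-⪯⁺ p)

  suc⋠zero : ∀ {a} → ¬ suc a ⪯[ E ] zero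
  suc⋠zero (⪯-step () _)

  suc-⪯⁻ : ∀ {a b} → suc a ⪯[ E ] suc b → a ⪯[ H ] b
  suc-⪯⁻ ⪯-refl                   = ⪯-refl
  suc-⪯⁻ (⪯-step {w = zero}  _ p) = ⊥-elim (suc⋠zero p)
  suc-⪯⁻ (⪯-step {w = suc _} e p) = ⪯-step e (suc-⪯⁻ p)

  zero⪯suc⁺ : ∀ {w b} → w ∈ W → w ⪯[ H ] b → zero ⪯[ E ] suc b
  zero⪯suc⁺ w∈W w⪯b =
    ⪯-trans (⪯-step (Equivalence.from T-≡ ([]=⇒lookup w∈W)) ⪯-refl) (suc-⪯⁺ w⪯b)

  zero⪯suc⁻ : ∀ {b} → zero ⪯[ E ] suc b → ∃ λ w → w ∈ W × w ⪯[ H ] b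
  zero⪯suc⁻ {b} (⪯-step {w = zero}  e _) = b , lookup⇒[]= b W (Equivalence.to T-≡ e) , ⪯-refl
  zero⪯suc⁻     (⪯-step {w = suc _} e p) =
    let (w , w∈W , w⪯c) = zero⪯suc⁻ p in w , w∈W , ⪯-step e w⪯c

  DAG-restrict : DAG E → DAG H
  DAG-restrict dag v (step e p) = dag (suc v) (step e (suc-⪯⁺ p))

  CommonAnc-restrict : ∀ {A y} → CommonAnc E A (suc y) → CommonAnc H (A ∘ suc) y
  CommonAnc-restrict c a Aa = suc-⪯⁻ (c (suc a) Aa)

  liftPred : Pred (Fin n) 0ℓ → Pred (Fin (suc n)) 0ℓ
  liftPred B zero    = ⊥
  liftPred B (suc b) = B b

  liftPred-dec : ∀ {B} → Decidable B → Decidable (liftPred B)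
  liftPred-dec B? zero    = no λ ()
  liftPred-dec B? (suc b) = B? b

  leastCA-restrict : HasLeastCommonAncestors E → HasLeastCommonAncestors H
  leastCA-restrict lca {B} B? (b , Bb) with lca (liftPred-dec B?) (suc b , Bb)
  ... | zero  , CA , _     = ⊥-elim (suc⋠zero (CA (suc b) Bb))
  ... | suc l , CA , least =
    l , CommonAnc-restrict CA , λ t t-CA → suc-⪯⁻ (least (suc t) (lift-CA t-CA))
    where
    lift-CA : ∀ {t} → CommonAnc H B t → CommonAnc E (liftPred B) (suc t)
    lift-CA c (suc b′) Bb′ = suc-⪯⁺ (c b′ Bb′)

  lift-pair-CA : ∀ {w v x} → w ∈ W → CommonAnc H (pair w v) x → CommonAnc E (pair zero (suc v)) (suc x)
  lift-pair-CA w∈W c = CommonAnc-pair (zero⪯suc⁺ w∈W (c _ (inj₁ refl))) (suc-⪯⁺ (c _ (inj₂ refl)))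

  least-𝓛 : DAG H → HasLeastCommonAncestors E → ∀ v → ∃ (IsLeastIn H (𝓛 H W v))
  least-𝓛 dagH lca v with lca (pair-dec zero (suc v)) (zero , inj₁ refl)
  ... | zero  , CA , _     = ⊥-elim (suc⋠zero (CA (suc v) (inj₂ refl)))
  ... | suc m , CA , least =
    let (w , w∈W , w⪯m) = zero⪯suc⁻ (CA zero (inj₁ refl))
        m-CA : CommonAnc H (pair w v) m
        m-CA = CommonAnc-pair w⪯m (suc-⪯⁻ (CA (suc v) (inj₂ refl)))
        m-min : ∀ u → CommonAnc H (pair w v) u → u ⪯[ H ] m → u ≡ m
        m-min u u-CA u⪯m = ⪯-antisym dagH u⪯m (suc-⪯⁻ (least (suc u) (lift-pair-CA w∈W u-CA)))
    in m , (w , w∈W , m-CA , m-min) ,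
       λ x (w′ , w′∈W , x-CA , _) → suc-⪯⁻ (least (suc x) (lift-pair-CA w′∈W x-CA))

  admissible : Fin n → DAG E → HasLeastCommonAncestors E → Admissible H W
  admissible v₀ dag lca =
    let dagH = DAG-restrict dag
        (_ , (w , w∈W , _) , _) = least-𝓛 dagH lca v₀
    in (w , w∈W) , λ v → least⇒uniqueMinimal dagH (proj₂ (least-𝓛 dagH lca v))

  leastCA-new-only : ∀ {A} → A zero → ¬ ∃ (A ∘ suc) → IsLeastIn E (CommonAnc E A) zero
  leastCA-new-only {A} A₀ none = CA , λ t t-CA → t-CA zero A₀
    where
    CA : CommonAnc E A zero
    CA zero    _  = ⪯-refl
    CA (suc b) Ab = ⊥-elim (none (b , Ab))

  leastCA-old-only : ∀ {A b l} → ¬ A zero → A (suc b) → IsLeastIn H (CommonAnc H (A ∘ suc)) l →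
                IsLeastIn E (CommonAnc E A) (suc l)
  leastCA-old-only {A} {b} {l} ¬A₀ Ab (l-CA , l-least) = CA , least
    where
    CA : CommonAnc E A (suc l)
    CA zero    A₀ = ⊥-elim (¬A₀ A₀)
    CA (suc a) Aa = suc-⪯⁺ (l-CA a Aa)
    least : ∀ t → CommonAnc E A t → suc l ⪯[ E ] t
    least zero    t-CA = ⊥-elim (suc⋠zero (t-CA (suc b) Ab))
    least (suc y) t-CA = suc-⪯⁺ (l-least y (CommonAnc-restrict t-CA))

  leastCA-mixed : DAG H → HasLeastCommonAncestors H → ∀ {A b l m} → A zero → A (suc b) →
                IsLeastIn H (CommonAnc H (A ∘ suc)) l → IsLeastIn H (𝓛 H W l) m →
                IsLeastIn E (CommonAnc E A) (suc m)
  leastCA-mixed dagH lca {A} {b} {l} {m} A₀ Ab (l-CA , l-least) ((w , w∈W , m-CA , _) , m-least) =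
    CA , least
    where
    CA : CommonAnc E A (suc m)
    CA zero    _  = zero⪯suc⁺ w∈W (m-CA w (inj₁ refl))
    CA (suc a) Aa = suc-⪯⁺ (⪯-trans (l-CA a Aa) (m-CA l (inj₂ refl)))
    least : ∀ t → CommonAnc E A t → suc m ⪯[ E ] t
    least zero    t-CA = ⊥-elim (suc⋠zero (t-CA (suc b) Ab))
    least (suc y) t-CA =
      let (w′ , w′∈W , w′⪯y) = zero⪯suc⁻ (t-CA zero A₀)
          (k , k-least) = lca (pair-dec w′ l) (w′ , inj₁ refl)
          y-CA : CommonAnc H (pair w′ l) y
          y-CA = CommonAnc-pair w′⪯y (l-least y (CommonAnc-restrict t-CA))
          k∈𝓛 : 𝓛 H W l k
          k∈𝓛 = w′ , w′∈W , least⇒minimal dagH k-least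
      in suc-⪯⁺ (⪯-trans (m-least k k∈𝓛) (proj₂ k-least y y-CA))

  leastCA-extend : DAG H → HasLeastCommonAncestors H → Admissible H W → HasLeastCommonAncestors E
  leastCA-extend dagH lca (_ , unique-𝓛) {A} A? (a , Aa) with any? (A? ∘ suc) | A? zero
  ... | no none | yes A₀ = zero , leastCA-new-only A₀ none
  ... | no none | no ¬A₀ = ⊥-elim ([ ¬A₀ , none ]′ (zero-or-old a Aa))
    where
    zero-or-old : ∀ a → A a → A zero ⊎ ∃ (A ∘ suc)
    zero-or-old zero    A₀ = inj₁ A₀
    zero-or-old (suc b) Ab = inj₂ (b , Ab)
  ... | yes (b , Ab) | no ¬A₀ =
    let (l , l-least) = lca (A? ∘ suc) (b , Ab) in suc l , leastCA-old-only ¬A₀ Ab l-least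
  ... | yes (b , Ab) | yes A₀ =
    let (l , l-least) = lca (A? ∘ suc) (b , Ab)
        (m , m-least) = uniqueMinimal⇒least dagH (𝓛-dec dagH W l) (unique-𝓛 l)
    in suc m , leastCA-mixed dagH lca A₀ Ab l-least m-least

K₁-leastCA : HasLeastCommonAncestors {1} (λ _ _ → false)
K₁-leastCA _ _ = zero , (λ { zero _ → ⪯-refl }) , λ { zero _ → ⪯-refl }

holjuBuilt⇒leastCA : ∀ {n} {H : Graph n} → HoljuBuilt n H → DAG H → HasLeastCommonAncestors H
holjuBuilt⇒leastCA K₁                _   = K₁-leastCA
holjuBuilt⇒leastCA (add W built adm) dag =
  let open Extension _ W
      dagH = DAG-restrict dag
  in leastCA-extend dagH (holjuBuilt⇒leastCA built dagH) adm

holju-extend : ∀ {n} {G : Graph (suc n)} {G′ W} → Fin n → G ≅ extend G′ W →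
               DAG G → HasLeastCommonAncestors G → Holju G′ → Holju G
holju-extend {G = G} {G′} {W} v₀ G≅E dag lca (H′ , H′-built , G′≅H′)
  with extend-≅ {G = G′} {H = H′} G′≅H′ W
... | W′ , E≅F = extend H′ W′ , add W′ H′-built (admissible v₀ dagF lcaF) , G≅F
  where
  open Extension H′ W′
  G≅F : G ≅ extend H′ W′
  G≅F = ≅-trans {H = extend G′ W} {K = extend H′ W′} G≅E E≅F
  dagF : DAG (extend H′ W′)
  dagF = DAG-transport G≅F dag
  lcaF : HasLeastCommonAncestors (extend H′ W′)
  lcaF = leastCA-transport G≅F lca

leastCA⇒holju : ∀ {n} {G : Graph n} → Fin n → DAG G → HasLeastCommonAncestors G → Holju G
leastCA⇒holju {1} {G} zero dag _ = _ , K₁ , id , edges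
  where
  edges : ∀ u v → G u v ≡ false
  edges zero zero = dec-false (T? (G zero zero)) (λ e → dag zero (step e ⪯-refl))
leastCA⇒holju {suc (suc _)} r dag lca =
  let (_ , x-leaf) = leaf-exists dag r
      (G′ , W , G≅E) = split-leaf x-leaf
      open Extension G′ W
      dagE = DAG-transport G≅E dag
      lcaE = leastCA-transport G≅E lca
  in holju-extend zero G≅E dag lca (leastCA⇒holju zero (DAG-restrict dagE) (leastCA-restrict lcaE))

theorem5p5 : ∀ (n : ℕ) (G : Graph n) → Network G → (GlobalLCA G ⇔ Holju G)
theorem5p5 _ _ (dag , r , _) = mk⇔
  (λ gl → leastCA⇒holju r dag (Equivalence.to (globalLCA⇔leastCA dag) gl))
  (λ (H , H-built , G≅H) → Equivalence.from (globalLCA⇔leastCA dag)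
     (leastCA-transport (≅-sym G≅H) (holjuBuilt⇒leastCA H-built (DAG-transport G≅H dag))))
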